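{- For a graph $G$ the following are equivalent: (i) $G$ is a 2-probe complete graph, i.e., $cow(G)\le 2$; (ii) $G$ is $(2K_2, P_4, K_3+K_1, (K_2+K_1)\star 2K_1, C_4\star 2K_1)$-free; (iii) $G$ is obtained from $G[2]=(K_2+K_1)\star K_1$ by substituting the universal vertex by a clique and the other vertices by independent sets.
   Context: All graphs are finite, simple and undirected. For a graph $G=(V,E)$, the complete width $cow(G)$ is the minimum $k\ge 0$ such that there exist $k$ independent sets $N_1,\dots,N_k\subseteq V$ with the property that for every two distinct non-adjacent vertices $x,y$ of $G$ there is an $i$ with $x,y\in N_i$. $G+H$ is the disjoint union; $tG$ is the disjoint union of $t$ copies of $G$; $G\star H$ (join) is $G+H$ with all edges between $V(G)$ and $V(H)$ added. $K_n$ is the complete graph, $P_4$ the path on 4 vertices, $C_4$ the 4-cycle. $(H_1,\dots,H_t)$-free means no induced subgraph isomorphic to any $H_i$. Substituting a vertex $v$ by a (possibly empty) graph $H$ means replacing $v$ by a disjoint copy of $H$ and joining every vertex of $H$ to every vertex of $N(v)$. -}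

module Defs where

open import Data.Nat using (ℕ; zero; suc; _+_; _≤_)
open import Data.Fin using (Fin; zero; suc; splitAt; _≟_)
open import Data.Bool using (Bool; true; false; not; if_then_else_)
open import Data.Sum using (_⊎_; inj₁; inj₂)
open import Data.Product using (Σ; ∃; _×_; _,_)
open import Relation.Nullary using (¬_; yes; no)
open import Relation.Nullary.Decidable using (⌊_⌋)
open import Relation.Binary.PropositionalEquality using (_≡_; _≢_; refl; sym)
open import Function.Definitions using (Injective)

record Graph : Set where
  field
    n       : ℕ
    adj     : Fin n → Fin n → Bool
    adj-sym : ∀ x y → adj x y ≡ adj y x
    adj-irr : ∀ x → adj x x ≡ false
open Graph public

K : ℕ → Graph
K m = record { n = m ; adj = λ x y → not ⌊ x ≟ y ⌋ ; adj-sym = s ; adj-irr = i }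
  where
  s : ∀ (x y : Fin m) → not ⌊ x ≟ y ⌋ ≡ not ⌊ y ≟ x ⌋
  s x y with x ≟ y | y ≟ x
  ... | yes _ | yes _ = refl
  ... | no _  | no _  = refl
  ... | yes p | no q  = Data.Empty.⊥-elim (q (sym p))
    where import Data.Empty
  ... | no p  | yes q = Data.Empty.⊥-elim (p (sym q))
    where import Data.Empty
  i : ∀ (x : Fin m) → not ⌊ x ≟ x ⌋ ≡ false
  i x with x ≟ x
  ... | yes _ = refl
  ... | no p  = Data.Empty.⊥-elim (p refl)
    where import Data.Empty

-- path P_4 : 0 - 1 - 2 - 3
P4-adj : Fin 4 → Fin 4 → Bool
P4-adj zero (suc zero) = true
P4-adj (suc zero) zero = true
P4-adj (suc zero) (suc (suc zero)) = true
P4-adj (suc (suc zero)) (suc zero) = true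
P4-adj (suc (suc zero)) (suc (suc (suc zero))) = true
P4-adj (suc (suc (suc zero))) (suc (suc zero)) = true
P4-adj _ _ = false

P4 : Graph
P4 = record { n = 4 ; adj = P4-adj ; adj-sym = s ; adj-irr = i }
  where
  s : ∀ x y → P4-adj x y ≡ P4-adj y x
  s zero zero = refl
  s zero (suc zero) = refl
  s zero (suc (suc zero)) = refl
  s zero (suc (suc (suc zero))) = refl
  s (suc zero) zero = refl
  s (suc zero) (suc zero) = refl
  s (suc zero) (suc (suc zero)) = refl
  s (suc zero) (suc (suc (suc zero))) = refl
  s (suc (suc zero)) zero = refl
  s (suc (suc zero)) (suc zero) = refl
  s (suc (suc zero)) (suc (suc zero)) = refl
  s (suc (suc zero)) (suc (suc (suc zero))) = refl
  s (suc (suc (suc zero))) zero = refl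
  s (suc (suc (suc zero))) (suc zero) = refl
  s (suc (suc (suc zero))) (suc (suc zero)) = refl
  s (suc (suc (suc zero))) (suc (suc (suc zero))) = refl
  i : ∀ x → P4-adj x x ≡ false
  i zero = refl
  i (suc zero) = refl
  i (suc (suc zero)) = refl
  i (suc (suc (suc zero))) = refl

-- cycle C_4 : 0 - 1 - 2 - 3 - 0
C4-adj : Fin 4 → Fin 4 → Bool
C4-adj zero (suc (suc (suc zero))) = true
C4-adj (suc (suc (suc zero))) zero = true
C4-adj x y = P4-adj x y

C4 : Graph
C4 = record { n = 4 ; adj = C4-adj ; adj-sym = s ; adj-irr = i }
  where
  s : ∀ x y → C4-adj x y ≡ C4-adj y x
  s zero zero = refl
  s zero (suc zero) = refl
  s zero (suc (suc zero)) = refl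
  s zero (suc (suc (suc zero))) = refl
  s (suc zero) zero = refl
  s (suc zero) (suc zero) = refl
  s (suc zero) (suc (suc zero)) = refl
  s (suc zero) (suc (suc (suc zero))) = refl
  s (suc (suc zero)) zero = refl
  s (suc (suc zero)) (suc zero) = refl
  s (suc (suc zero)) (suc (suc zero)) = refl
  s (suc (suc zero)) (suc (suc (suc zero))) = refl
  s (suc (suc (suc zero))) zero = refl
  s (suc (suc (suc zero))) (suc zero) = refl
  s (suc (suc (suc zero))) (suc (suc zero)) = refl
  s (suc (suc (suc zero))) (suc (suc (suc zero))) = refl
  i : ∀ x → C4-adj x x ≡ false
  i zero = refl
  i (suc zero) = refl
  i (suc (suc zero)) = refl
  i (suc (suc (suc zero))) = refl

-- Disjoint union and join.  Vertices of G and H are Fin (n G + n H),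
-- split by splitAt; `cross` is the adjacency between the two sides
-- (false = disjoint union, true = join).

module _ (cross : Bool) (G H : Graph) where
  sumAdj : Fin (n G) ⊎ Fin (n H) → Fin (n G) ⊎ Fin (n H) → Bool
  sumAdj (inj₁ x) (inj₁ y) = adj G x y
  sumAdj (inj₂ x) (inj₂ y) = adj H x y
  sumAdj (inj₁ _) (inj₂ _) = cross
  sumAdj (inj₂ _) (inj₁ _) = cross

  sumAdj-sym : ∀ a b → sumAdj a b ≡ sumAdj b a
  sumAdj-sym (inj₁ x) (inj₁ y) = adj-sym G x y
  sumAdj-sym (inj₂ x) (inj₂ y) = adj-sym H x y
  sumAdj-sym (inj₁ _) (inj₂ _) = refl
  sumAdj-sym (inj₂ _) (inj₁ _) = refl

  sumAdj-irr : ∀ a → sumAdj a a ≡ false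
  sumAdj-irr (inj₁ x) = adj-irr G x
  sumAdj-irr (inj₂ x) = adj-irr H x

  combine : Graph
  combine = record
    { n = n G + n H
    ; adj = λ x y → sumAdj (splitAt (n G) x) (splitAt (n G) y)
    ; adj-sym = λ x y → sumAdj-sym (splitAt (n G) x) (splitAt (n G) y)
    ; adj-irr = λ x → sumAdj-irr (splitAt (n G) x)
    }

infixl 6 _⊕_
infixl 5 _⋆_

_⊕_ : Graph → Graph → Graph
G ⊕ H = combine false G H

_⋆_ : Graph → Graph → Graph
G ⋆ H = combine true G H

copies : ℕ → Graph → Graph
copies zero G = K 0
copies (suc zero) G = G
copies (suc (suc t)) G = copies (suc t) G ⊕ G

ContainsInduced : Graph → Graph → Set
ContainsInduced G H =
  Σ (Fin (n H) → Fin (n G)) λ f →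
    Injective _≡_ _≡_ f × (∀ x y → adj G (f x) (f y) ≡ adj H x y)

Free : Graph → Graph → Set
Free G H = ¬ ContainsInduced G H

VSet : Graph → Set
VSet G = Fin (n G) → Bool

Independent : (G : Graph) → VSet G → Set
Independent G S = ∀ x y → S x ≡ true → S y ≡ true → adj G x y ≡ false

CompleteCover : (G : Graph) → ℕ → Set
CompleteCover G k =
  Σ (Fin k → VSet G) λ N →
    (∀ i → Independent G (N i)) ×
    (∀ x y → x ≢ y → adj G x y ≡ false →
       ∃ λ i → N i x ≡ true × N i y ≡ true)

-- cow(G) ≤ k  (cow(G) is the least k admitting a complete cover)
CowAtMost : Graph → ℕ → Set
CowAtMost G k = ∃ λ k′ → k′ ≤ k × CompleteCover G k′

-- Given a graph H and, for each vertex v of H, a flag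
-- clique? v (true = substitute v by a clique, false = by an independent
-- set), G is obtained from H by substituting each v by a (possibly empty)
-- clique / independent set iff V(G) can be partitioned into parts
-- φ⁻¹(v) (possibly empty) such that distinct vertices in the same part
-- v are adjacent iff clique? v, and vertices in distinct parts v ≠ w are
-- adjacent iff v w is an edge of H.

ObtainedBySubst : (G H : Graph) → (Fin (n H) → Bool) → Set
ObtainedBySubst G H clique? =
  Σ (Fin (n G) → Fin (n H)) λ φ →
    ∀ x y → x ≢ y →
      adj G x y ≡ (if ⌊ φ x ≟ φ y ⌋ then clique? (φ x) else adj H (φ x) (φ y))

-- G[2] = (K_2 + K_1) ⋆ K_1 ; vertices 0,1 (the K_2), 2 (the K_1),
-- 3 (the universal vertex)
G2 : Graph
G2 = (K 2 ⊕ K 1) ⋆ K 1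

G2-clique? : Fin 4 → Bool
G2-clique? (suc (suc (suc zero))) = true
G2-clique? _ = false

2K1 2K2 : Graph
2K1 = copies 2 (K 1)
2K2 = copies 2 (K 2)

Forbidden12 : Graph → Set
Forbidden12 G =
  Free G 2K2 × Free G P4 × Free G (K 3 ⊕ K 1) ×
  Free G ((K 2 ⊕ K 1) ⋆ 2K1) × Free G (C4 ⋆ 2K1)

-- Label every vertex by the subset of {1, 2} of indices i with x ∈ Nᵢ.  Then
-- cow(G) ≤ 2 says exactly that distinct vertices are adjacent iff their labels
-- are disjoint, and the four labels {1}, {2}, {1, 2}, ∅ are the four vertices of
-- G[2], so such labellings are the same as blow-ups of G[2].  Labellings restrict
-- to induced subgraphs, and a finite search shows that none of the five forbidden
-- graphs has one.  Conversely, in a graph without the forbidden subgraphs the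
-- non-universal vertices span no triangle; being also P₄- and 2K₂-free they
-- induce a complete bipartite graph plus isolated vertices, and labelling the
-- universal vertices ∅, the isolated ones {1, 2} and the two sides {1} and {2}
-- works.
module Submission where

open import Defs
open import Data.Product using (_×_)
open import Function.Bundles using (_⇔_)

open import Data.Bool as Bool using (Bool; true; false; not; _∧_; _∨_; if_then_else_)
open import Data.Bool.Properties using (∧-comm; ∨-zeroʳ; ¬-not)
open import Data.Empty using (⊥; ⊥-elim)
open import Data.Fin using (Fin; zero; suc; _≟_; _<_; _<?_)
open import Data.Fin.Properties using (all?; any?; <-cmp)
open import Data.Fin.Subset using (Subset)
open import Data.Fin.Subset.Properties using (anySubset?)
open import Data.List using (List; allFin; cartesianProduct; filter)
open import Data.List.Membership.Propositional using (_∈_)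
open import Data.List.Membership.Propositional.Properties
  using (∈-filter⁺; ∈-allFin; ∈-cartesianProduct⁺)
open import Data.List.Relation.Unary.All as All using (All; []; _∷_)
open import Data.Nat using (suc; _≤′_; ≤′-refl; ≤′-step)
open import Data.Nat.Properties using (≤-refl; ≤⇒≤′)
open import Data.Product using (Σ; ∃; _,_; proj₁; proj₂; uncurry)
open import Data.Vec as Vec using (Vec; []; _∷_; tabulate)
open import Data.Vec.Properties using (lookup∘tabulate)
open import Function using (_∘_)
open import Function.Bundles using (Equivalence; mk⇔)
open import Function.Definitions using (Injective)
open import Relation.Binary.Definitions using (tri<; tri≈; tri>)
open import Relation.Binary.PropositionalEquality
open import Relation.Nullary using (Dec; yes; no; ¬_; ¬?)
open import Relation.Nullary.Decidable as Dec
  using (⌊_⌋; _×-dec_; _→-dec_; False; toWitnessFalse)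

Label : Set
Label = Bool × Bool

disjoint : Label → Label → Bool
disjoint (a₁ , a₂) (b₁ , b₂) = not (a₁ ∧ b₁ ∨ a₂ ∧ b₂)

disjoint-comm : ∀ a b → disjoint a b ≡ disjoint b a
disjoint-comm (a₁ , a₂) (b₁ , b₂) = cong₂ (λ s t → not (s ∨ t)) (∧-comm a₁ b₁) (∧-comm a₂ b₂)

disjoint-∅ʳ : ∀ a → disjoint a (false , false) ≡ true
disjoint-∅ʳ a = disjoint-comm a (false , false)

component : Fin 2 → Label → Bool
component zero       = proj₁
component (suc zero) = proj₂

shared⇒¬disjoint : ∀ i a b → component i a ≡ true → component i b ≡ true → disjoint a b ≡ false
shared⇒¬disjoint zero       (true , _)  (true , _)  refl refl = refl
shared⇒¬disjoint (suc zero) (a₁ , true) (b₁ , true) refl refl = cong not (∨-zeroʳ (a₁ ∧ b₁))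

¬disjoint⇒shared : ∀ a b → disjoint a b ≡ false →
                   ∃ λ i → component i a ≡ true × component i b ≡ true
¬disjoint⇒shared (true , _)      (true , _)  _ = zero , refl , refl
¬disjoint⇒shared (_ , true)      (_ , true)  _ = suc zero , refl , refl
¬disjoint⇒shared (false , false) _           ()
¬disjoint⇒shared (true , false)  (false , _) ()
¬disjoint⇒shared (false , true)  (_ , false) ()

Represents : (G : Graph) → (Fin (n G) → Label) → Set
Represents G ℓ = ∀ x y → x ≢ y → adj G x y ≡ disjoint (ℓ x) (ℓ y)

DisjointnessLabelling : Graph → Set
DisjointnessLabelling G = Σ (Fin (n G) → Label) (Represents G)

-- Complete covers by two sets

module _ {G : Graph} where

  cover-suc : ∀ {k} → CompleteCover G k → CompleteCover G (suc k)
  cover-suc {k} (N , independent , covers) = N′ , independent′ , covers′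
    where
    N′ : Fin (suc k) → VSet G
    N′ zero    _ = false
    N′ (suc i)   = N i
    independent′ : ∀ i → Independent G (N′ i)
    independent′ zero    _ _ ()
    independent′ (suc i) = independent i
    covers′ : ∀ x y → x ≢ y → adj G x y ≡ false → ∃ λ i → N′ i x ≡ true × N′ i y ≡ true
    covers′ x y x≢y xy with covers x y x≢y xy
    ... | i , shared = suc i , shared

  cover-mono : ∀ {k k′} → k ≤′ k′ → CompleteCover G k → CompleteCover G k′
  cover-mono ≤′-refl       cover = cover
  cover-mono (≤′-step k≤k′) cover = cover-suc (cover-mono k≤k′ cover)

  independent-∧ : ∀ {S} → Independent G S → ∀ {x y} → adj G x y ≡ true → S x ∧ S y ≡ false
  independent-∧ {S} independent {x} {y} xy with S x in x∈S | S y in y∈S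
  ... | true  | true  with () ← trans (sym xy) (independent x y x∈S y∈S)
  ... | true  | false = refl
  ... | false | _     = refl

  cover⇒labelling : CompleteCover G 2 → DisjointnessLabelling G
  cover⇒labelling (N , independent , covers) = ℓ , represents
    where
    ℓ : Fin (n G) → Label
    ℓ x = N zero x , N (suc zero) x
    represents : Represents G ℓ
    represents x y x≢y with adj G x y in xy
    ... | true = sym (cong₂ (λ s t → not (s ∨ t))
                        (independent-∧ (independent zero) xy)
                        (independent-∧ (independent (suc zero)) xy))
    ... | false with covers x y x≢y xy
    ...   | zero     , x∈N , y∈N = sym (shared⇒¬disjoint zero (ℓ x) (ℓ y) x∈N y∈N)
    ...   | suc zero , x∈N , y∈N = sym (shared⇒¬disjoint (suc zero) (ℓ x) (ℓ y) x∈N y∈N)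

  labelling⇒cover : DisjointnessLabelling G → CompleteCover G 2
  labelling⇒cover (ℓ , represents) = N , independent , covers
    where
    N : Fin 2 → VSet G
    N i = component i ∘ ℓ
    independent : ∀ i → Independent G (N i)
    independent i x y x∈N y∈N with x ≟ y
    ... | yes refl = adj-irr G x
    ... | no x≢y   = trans (represents x y x≢y) (shared⇒¬disjoint i (ℓ x) (ℓ y) x∈N y∈N)
    covers : ∀ x y → x ≢ y → adj G x y ≡ false → ∃ λ i → N i x ≡ true × N i y ≡ true
    covers x y x≢y xy = ¬disjoint⇒shared (ℓ x) (ℓ y) (trans (sym (represents x y x≢y)) xy)

  cow≤2⇔labelling : CowAtMost G 2 ⇔ DisjointnessLabelling G
  cow≤2⇔labelling =
    mk⇔ (λ (k , k≤2 , cover) → cover⇒labelling (cover-mono (≤⇒≤′ k≤2) cover))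
        (λ labelling → 2 , ≤-refl , labelling⇒cover labelling)

-- Blow-ups of G[2]

labelOf : Fin 4 → Label
labelOf zero                   = true , false
labelOf (suc zero)             = false , true
labelOf (suc (suc zero))       = true , true
labelOf (suc (suc (suc zero))) = false , false

vertexOf : Label → Fin 4
vertexOf (true , false)  = zero
vertexOf (false , true)  = suc zero
vertexOf (true , true)   = suc (suc zero)
vertexOf (false , false) = suc (suc (suc zero))

labelOf∘vertexOf : ∀ a → labelOf (vertexOf a) ≡ a
labelOf∘vertexOf (true , false)  = refl
labelOf∘vertexOf (false , true)  = refl
labelOf∘vertexOf (true , true)   = refl
labelOf∘vertexOf (false , false) = refl

blowUpAdj : Fin 4 → Fin 4 → Bool
blowUpAdj i j = if ⌊ i ≟ j ⌋ then G2-clique? i else adj G2 i j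

blowUpAdj≡disjoint : ∀ i j → blowUpAdj i j ≡ disjoint (labelOf i) (labelOf j)
blowUpAdj≡disjoint = Dec.toWitness {a? = all? λ i → all? λ j →
                                      blowUpAdj i j Bool.≟ disjoint (labelOf i) (labelOf j)} _

module _ {G : Graph} where

  labelling⇒blowUp : DisjointnessLabelling G → ObtainedBySubst G G2 G2-clique?
  labelling⇒blowUp (ℓ , represents) = vertexOf ∘ ℓ , λ x y x≢y → begin
    adj G x y
      ≡⟨ represents x y x≢y ⟩
    disjoint (ℓ x) (ℓ y)
      ≡⟨ cong₂ disjoint (labelOf∘vertexOf (ℓ x)) (labelOf∘vertexOf (ℓ y)) ⟨
    disjoint (labelOf (vertexOf (ℓ x))) (labelOf (vertexOf (ℓ y)))
      ≡⟨ blowUpAdj≡disjoint (vertexOf (ℓ x)) (vertexOf (ℓ y)) ⟨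
    blowUpAdj (vertexOf (ℓ x)) (vertexOf (ℓ y))
      ∎
    where open ≡-Reasoning

  blowUp⇒labelling : ObtainedBySubst G G2 G2-clique? → DisjointnessLabelling G
  blowUp⇒labelling (φ , substituted) = labelOf ∘ φ , λ x y x≢y →
    trans (substituted x y x≢y) (blowUpAdj≡disjoint (φ x) (φ y))

-- The forbidden graphs have no labelling

fromSubsets : ∀ {m} → Subset m → Subset m → Fin m → Label
fromSubsets S₁ S₂ x = Vec.lookup S₁ x , Vec.lookup S₂ x

fromSubsets-tabulate : ∀ {m} (ℓ : Fin m → Label) x →
                       fromSubsets (tabulate (proj₁ ∘ ℓ)) (tabulate (proj₂ ∘ ℓ)) x ≡ ℓ x
fromSubsets-tabulate ℓ x = cong₂ _,_ (lookup∘tabulate (proj₁ ∘ ℓ) x) (lookup∘tabulate (proj₂ ∘ ℓ) x)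

represents? : ∀ G ℓ → Dec (Represents G ℓ)
represents? G ℓ = all? λ x → all? λ y → ¬? (x ≟ y) →-dec (adj G x y Bool.≟ disjoint (ℓ x) (ℓ y))

labelling? : ∀ G → Dec (DisjointnessLabelling G)
labelling? G = Dec.map (mk⇔ fromPair toPair)
  (anySubset? λ S₁ → anySubset? λ S₂ → represents? G (fromSubsets S₁ S₂))
  where
  SubsetLabelling : Set
  SubsetLabelling = ∃ λ S₁ → ∃ λ S₂ → Represents G (fromSubsets S₁ S₂)
  fromPair : SubsetLabelling → DisjointnessLabelling G
  fromPair (S₁ , S₂ , represents) = fromSubsets S₁ S₂ , represents
  toPair : DisjointnessLabelling G → SubsetLabelling
  toPair (ℓ , represents) = tabulate (proj₁ ∘ ℓ) , tabulate (proj₂ ∘ ℓ) , λ x y x≢y →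
    subst₂ (λ a b → adj G x y ≡ disjoint a b)
           (sym (fromSubsets-tabulate ℓ x)) (sym (fromSubsets-tabulate ℓ y)) (represents x y x≢y)

labelling-induced : ∀ {G H} → ContainsInduced G H → DisjointnessLabelling G → DisjointnessLabelling H
labelling-induced (f , injective , preserves) (ℓ , represents) =
  ℓ ∘ f , λ x y x≢y → trans (sym (preserves x y)) (represents (f x) (f y) (x≢y ∘ injective))

labelling⇒forbidden-free : ∀ {G} → DisjointnessLabelling G → Forbidden12 G
labelling⇒forbidden-free {G} labelling =
  excludes 2K2 _ , excludes P4 _ , excludes (K 3 ⊕ K 1) _ ,
  excludes ((K 2 ⊕ K 1) ⋆ 2K1) _ , excludes (C4 ⋆ 2K1) _
  where
  -- Each `_` above is an exhaustive search over all labellings of H, carried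
  -- out by the type checker when it normalises `False (labelling? H)`.
  excludes : ∀ H → False (labelling? H) → Free G H
  excludes H unlabellable copy =
    toWitnessFalse {a? = labelling? H} unlabellable (labelling-induced {G} {H} copy labelling)

Twins : (H : Graph) → Fin (n H) → Fin (n H) → Set
Twins H i j = ∀ k → adj H i k ≡ adj H j k

twins? : ∀ H i j → Dec (Twins H i j)
twins? H i j = all? λ k → adj H i k Bool.≟ adj H j k

orderedPairs : ∀ m → List (Fin m × Fin m)
orderedPairs m = filter (uncurry _<?_) (cartesianProduct (allFin m) (allFin m))

orderedTwins : (H : Graph) → List (Fin (n H) × Fin (n H))
orderedTwins H = filter (uncurry (twins? H)) (orderedPairs (n H))

∈-orderedPairs : ∀ {m} {i j : Fin m} → i < j → (i , j) ∈ orderedPairs m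
∈-orderedPairs i<j = ∈-filter⁺ (uncurry _<?_) (∈-cartesianProduct⁺ (∈-allFin _) (∈-allFin _)) i<j

∈-orderedTwins : ∀ {H i j} → i < j → Twins H i j → (i , j) ∈ orderedTwins H
∈-orderedTwins {H} i<j twins = ∈-filter⁺ (uncurry (twins? H)) (∈-orderedPairs i<j) twins

-- A map preserving adjacency can only identify twins, so it is an embedding as
-- soon as it separates the twins of H.
module _ (G H : Graph) (f : Fin (n H) → Fin (n G)) where

  AgreesOnOrderedPairs : Set
  AgreesOnOrderedPairs = All (λ (i , j) → adj G (f i) (f j) ≡ adj H i j) (orderedPairs (n H))

  SeparatesTwins : Set
  SeparatesTwins = All (λ (i , j) → f i ≢ f j) (orderedTwins H)

  preserves-adj : AgreesOnOrderedPairs → ∀ i j → adj G (f i) (f j) ≡ adj H i j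
  preserves-adj agrees i j with <-cmp i j
  ... | tri< i<j _ _ = All.lookup agrees (∈-orderedPairs i<j)
  ... | tri≈ _ refl _ = trans (adj-irr G (f i)) (sym (adj-irr H i))
  ... | tri> _ _ j<i = begin
    adj G (f i) (f j) ≡⟨ adj-sym G (f i) (f j) ⟩
    adj G (f j) (f i) ≡⟨ All.lookup agrees (∈-orderedPairs j<i) ⟩
    adj H j i         ≡⟨ adj-sym H j i ⟩
    adj H i j         ∎
    where open ≡-Reasoning

  identified⇒twins : (∀ i j → adj G (f i) (f j) ≡ adj H i j) → ∀ {i j} → f i ≡ f j → Twins H i j
  identified⇒twins preserves {i} {j} fi≡fj k =
    trans (sym (preserves i k)) (trans (cong (λ v → adj G v (f k)) fi≡fj) (preserves j k))

  induced-copy : AgreesOnOrderedPairs → SeparatesTwins → ContainsInduced G H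
  induced-copy agrees separates = f , injective , preserves
    where
    preserves = preserves-adj agrees
    injective : Injective _≡_ _≡_ f
    injective {i} {j} fi≡fj with <-cmp i j
    ... | tri< i<j _ _ = ⊥-elim (All.lookup separates
                                   (∈-orderedTwins {H} i<j (identified⇒twins preserves fi≡fj)) fi≡fj)
    ... | tri≈ _ i≡j _ = i≡j
    ... | tri> _ _ j<i = ⊥-elim (All.lookup separates
                                   (∈-orderedTwins {H} j<i (identified⇒twins preserves (sym fi≡fj)))
                                   (sym fi≡fj))

-- Graphs without the forbidden subgraphs

module ForbiddenFree
  (G : Graph)
  (no2K2 : Free G 2K2) (noP4 : Free G P4) (noK3+K1 : Free G (K 3 ⊕ K 1))
  (noK2+K1⋆2K1 : Free G ((K 2 ⊕ K 1) ⋆ 2K1)) (noC4⋆2K1 : Free G (C4 ⋆ 2K1))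
  where

  V : Set
  V = Fin (n G)

  _~_ _≁_ : V → V → Set
  x ~ y = adj G x y ≡ true
  x ≁ y = adj G x y ≡ false

  swap : ∀ {x y b} → adj G x y ≡ b → adj G y x ≡ b
  swap {x} {y} = trans (adj-sym G y x)

  -- `vs` lists the images of the vertices of H; the adjacency facts are given for
  -- the pairs 01, 02, …, 12, … of `orderedPairs`, in lexicographic order.
  excluded : ∀ {H} → Free G H → (vs : Vec V (n H)) →
             AgreesOnOrderedPairs G H (Vec.lookup vs) → SeparatesTwins G H (Vec.lookup vs) → ⊥
  excluded {H} free vs agrees separates = free (induced-copy G H (Vec.lookup vs) agrees separates)

  Universal NonUniversal HasNonUniversalNeighbour Core : V → Set
  Universal x = ∀ y → x ≢ y → x ~ y
  NonUniversal x = ∃ λ y → x ≢ y × x ≁ y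
  HasNonUniversalNeighbour x = ∃ λ y → x ~ y × NonUniversal y
  Core x = NonUniversal x × HasNonUniversalNeighbour x

  nonUniversal? : ∀ x → Dec (NonUniversal x)
  nonUniversal? x = any? λ y → ¬? (x ≟ y) ×-dec (adj G x y Bool.≟ false)

  hasNonUniversalNeighbour? : ∀ x → Dec (HasNonUniversalNeighbour x)
  hasNonUniversalNeighbour? x = any? λ y → (adj G x y Bool.≟ true) ×-dec nonUniversal? y

  core? : ∀ x → Dec (Core x)
  core? x = nonUniversal? x ×-dec hasNonUniversalNeighbour? x

  sees-one-corner : ∀ {p q r u} → p ~ q → q ~ r → p ~ r → NonUniversal r →
                    u ≁ p → u ≁ q → u ~ r → ⊥
  sees-one-corner {p} {q} {r} {u} pq qr pr (w , r≢w , rw) up uq ur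
    with adj G w u in wu | adj G w p in wp | adj G w q in wq
  ... | false | true  | true  =
    excluded {P4} noP4 (u ∷ r ∷ p ∷ w ∷ []) (ur ∷ up ∷ swap wu ∷ swap pr ∷ rw ∷ swap wp ∷ []) []
  ... | false | true  | false =
    excluded {P4} noP4 (w ∷ p ∷ r ∷ u ∷ []) (wp ∷ swap rw ∷ wu ∷ pr ∷ swap up ∷ swap ur ∷ []) []
  ... | false | false | true  =
    excluded {P4} noP4 (w ∷ q ∷ r ∷ u ∷ []) (wq ∷ swap rw ∷ wu ∷ qr ∷ swap uq ∷ swap ur ∷ []) []
  ... | false | false | false =
    excluded {K 3 ⊕ K 1} noK3+K1 (p ∷ q ∷ r ∷ w ∷ []) (pq ∷ pr ∷ swap wp ∷ qr ∷ swap wq ∷ rw ∷ []) []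
  ... | true  | false | _     =
    excluded {P4} noP4 (w ∷ u ∷ r ∷ p ∷ []) (wu ∷ swap rw ∷ wp ∷ ur ∷ up ∷ swap pr ∷ []) []
  ... | true  | true  | false =
    excluded {P4} noP4 (w ∷ u ∷ r ∷ q ∷ []) (wu ∷ swap rw ∷ wq ∷ ur ∷ uq ∷ swap qr ∷ []) []
  ... | true  | true  | true  =
    excluded {(K 2 ⊕ K 1) ⋆ 2K1} noK2+K1⋆2K1 (p ∷ q ∷ u ∷ r ∷ w ∷ [])
      (pq ∷ swap up ∷ pr ∷ swap wp ∷ swap uq ∷ qr ∷ swap wq ∷ ur ∷ swap wu ∷ rw ∷ [])
      (r≢w ∷ [])

  sees-two-corners : ∀ {p q r x} → p ~ q → q ~ r → p ~ r → NonUniversal q → NonUniversal r →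
                     x ≁ p → x ~ q × x ~ r
  sees-two-corners {p} {q} {r} {x} pq qr pr q-nu r-nu xp with adj G x q in xq | adj G x r in xr
  ... | true  | true  = refl , refl
  ... | false | true  = ⊥-elim (sees-one-corner pq qr pr r-nu xp xq xr)
  ... | true  | false = ⊥-elim (sees-one-corner pr (swap qr) pq q-nu xp xr xq)
  ... | false | false = ⊥-elim
    (excluded {K 3 ⊕ K 1} noK3+K1 (p ∷ q ∷ r ∷ x ∷ []) (pq ∷ pr ∷ swap xp ∷ qr ∷ swap xq ∷ swap xr ∷ []) [])

  nonuniversal-triangle-free : ∀ {p q r} → NonUniversal p → NonUniversal q → NonUniversal r →
                               p ~ q → q ~ r → p ~ r → ⊥
  nonuniversal-triangle-free {p} {q} {r} p-nu@(x , p≢x , px) q-nu@(y , q≢y , qy) r-nu@(z , r≢z , rz)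
                             pq qr pr
    with sees-two-corners pq qr pr q-nu r-nu (swap px)
       | sees-two-corners (swap pq) pr qr p-nu r-nu (swap qy)
       | sees-two-corners (swap pr) pq (swap qr) p-nu q-nu (swap rz)
  ... | xq , xr | yp , yr | zp , zq with adj G x y in xy | adj G x z in xz | adj G y z in yz
  ... | false | _     | _     =
    excluded {P4} noP4 (y ∷ p ∷ q ∷ x ∷ []) (yp ∷ swap qy ∷ swap xy ∷ pq ∷ px ∷ swap xq ∷ []) []
  ... | true  | false | _     =
    excluded {P4} noP4 (z ∷ p ∷ r ∷ x ∷ []) (zp ∷ swap rz ∷ swap xz ∷ pr ∷ px ∷ swap xr ∷ []) []
  ... | true  | true  | false =
    excluded {P4} noP4 (z ∷ q ∷ r ∷ y ∷ []) (zq ∷ swap rz ∷ swap yz ∷ qr ∷ qy ∷ swap yr ∷ []) []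
  ... | true  | true  | true  =
    excluded {C4 ⋆ 2K1} noC4⋆2K1 (q ∷ r ∷ y ∷ z ∷ p ∷ x ∷ [])
      (qr ∷ qy ∷ swap zq ∷ swap pq ∷ swap xq ∷ swap yr ∷ rz ∷ swap pr ∷ swap xr ∷
       yz ∷ yp ∷ swap xy ∷ zp ∷ swap xz ∷ px ∷ [])
      (q≢y ∷ r≢z ∷ p≢x ∷ [])

  common-neighbours-nonadjacent : ∀ {d x y} → NonUniversal d → NonUniversal x → NonUniversal y →
                                  d ~ x → d ~ y → x ≁ y
  common-neighbours-nonadjacent d-nu x-nu y-nu dx dy =
    ¬-not λ xy → nonuniversal-triangle-free d-nu x-nu y-nu dx xy dy

  common-non-neighbours-nonadjacent : ∀ {d x y} → HasNonUniversalNeighbour d →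
                                      NonUniversal x → NonUniversal y → d ≁ x → d ≁ y → x ≁ y
  common-non-neighbours-nonadjacent {d} {x} {y} (e , de , e-nu) x-nu y-nu dx dy
    with adj G x y in xy
  ... | false = refl
  ... | true with adj G e x in ex | adj G e y in ey
  ...   | true  | true  = ⊥-elim (nonuniversal-triangle-free e-nu x-nu y-nu ex xy ey)
  ...   | false | false = ⊥-elim
    (excluded {2K2} no2K2 (d ∷ e ∷ x ∷ y ∷ []) (de ∷ dx ∷ dy ∷ ex ∷ ey ∷ xy ∷ []) [])
  ...   | true  | false = ⊥-elim
    (excluded {P4} noP4 (d ∷ e ∷ x ∷ y ∷ []) (de ∷ dx ∷ dy ∷ ex ∷ ey ∷ xy ∷ []) [])
  ...   | false | true  = ⊥-elim
    (excluded {P4} noP4 (d ∷ e ∷ y ∷ x ∷ []) (de ∷ dy ∷ dx ∷ ey ∷ ex ∷ swap xy ∷ []) [])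

  neighbour-adjacent-to-non-neighbour : ∀ {d x y} → NonUniversal d → NonUniversal x →
                                        HasNonUniversalNeighbour y → d ~ x → d ≁ y → x ~ y
  neighbour-adjacent-to-non-neighbour {d} {x} {y} d-nu x-nu (e , ye , e-nu) dx dy
    with adj G x y in xy
  ... | true = refl
  ... | false with adj G e d in ed | adj G e x in ex
  ...   | true  | true  = ⊥-elim (nonuniversal-triangle-free e-nu d-nu x-nu ed dx ex)
  ...   | false | false = ⊥-elim
    (excluded {2K2} no2K2 (d ∷ x ∷ e ∷ y ∷ []) (dx ∷ swap ed ∷ dy ∷ swap ex ∷ xy ∷ swap ye ∷ []) [])
  ...   | true  | false = ⊥-elim
    (excluded {P4} noP4 (x ∷ d ∷ e ∷ y ∷ []) (swap dx ∷ swap ex ∷ xy ∷ swap ed ∷ dy ∷ swap ye ∷ []) [])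
  ...   | false | true  = ⊥-elim
    (excluded {P4} noP4 (d ∷ x ∷ e ∷ y ∷ []) (dx ∷ swap ed ∷ dy ∷ swap ex ∷ xy ∷ swap ye ∷ []) [])

  sideLabel : Bool → Label
  sideLabel true  = false , true
  sideLabel false = true , false

  -- The core vertices induce a complete bipartite graph with sides N(d₀) and its complement.
  core-bipartite : ∀ {d₀ x y} → Core d₀ → Core x → Core y →
                   adj G x y ≡ disjoint (sideLabel (adj G d₀ x)) (sideLabel (adj G d₀ y))
  core-bipartite {d₀} {x} {y} (d₀-nu , d₀-nbr) (x-nu , x-nbr) (y-nu , y-nbr)
    with adj G d₀ x in d₀x | adj G d₀ y in d₀y
  ... | true  | true  = common-neighbours-nonadjacent d₀-nu x-nu y-nu d₀x d₀y
  ... | false | false = common-non-neighbours-nonadjacent d₀-nbr x-nu y-nu d₀x d₀y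
  ... | true  | false = neighbour-adjacent-to-non-neighbour d₀-nu x-nu y-nbr d₀x d₀y
  ... | false | true  = swap (neighbour-adjacent-to-non-neighbour d₀-nu y-nu x-nbr d₀y d₀x)

  data Kind (x : V) : Set where
    universal : Universal x → Kind x
    isolated  : NonUniversal x → ¬ HasNonUniversalNeighbour x → Kind x
    core      : Core x → Kind x

  kind : ∀ x → Kind x
  kind x with nonUniversal? x | hasNonUniversalNeighbour? x
  ... | no ¬nu  | _       = universal λ y x≢y → ¬-not λ xy → ¬nu (y , x≢y , xy)
  ... | yes nu  | yes nbr = core (nu , nbr)
  ... | yes nu  | no ¬nbr = isolated nu ¬nbr

  isolated-nonadjacent : ∀ {x y} → ¬ HasNonUniversalNeighbour x → NonUniversal y → x ≁ y
  isolated-nonadjacent ¬nbr y-nu = ¬-not λ xy → ¬nbr (_ , xy , y-nu)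

  labelOfKind : (V → Bool) → ∀ x → Kind x → Label
  labelOfKind side x (universal _)  = false , false
  labelOfKind side x (isolated _ _) = true , true
  labelOfKind side x (core _)       = sideLabel (side x)

  labelling-from-sides : (side : V → Bool) →
                         (∀ {x y} → Core x → Core y →
                           adj G x y ≡ disjoint (sideLabel (side x)) (sideLabel (side y))) →
                         DisjointnessLabelling G
  labelling-from-sides side core-sides = (λ x → labelOfKind side x (kind x)) , represents
    where
    sideLabel-¬∅ : ∀ b → disjoint (true , true) (sideLabel b) ≡ false
    sideLabel-¬∅ true  = refl
    sideLabel-¬∅ false = refl
    represents : Represents G (λ x → labelOfKind side x (kind x))
    represents x y x≢y with kind x | kind y
    ... | universal x-univ  | _                 = x-univ y x≢y
    ... | isolated _ _      | universal y-univ  = swap (y-univ x (x≢y ∘ sym))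
    ... | core _            | universal y-univ  =
      trans (swap (y-univ x (x≢y ∘ sym))) (sym (disjoint-∅ʳ (sideLabel (side x))))
    ... | isolated _ ¬nbr   | isolated y-nu _   = isolated-nonadjacent ¬nbr y-nu
    ... | isolated _ ¬nbr   | core (y-nu , _)   =
      trans (isolated-nonadjacent ¬nbr y-nu) (sym (sideLabel-¬∅ (side y)))
    ... | core (x-nu , _)   | isolated _ ¬nbr   =
      trans (swap (isolated-nonadjacent ¬nbr x-nu))
            (sym (trans (disjoint-comm (sideLabel (side x)) _) (sideLabel-¬∅ (side x))))
    ... | core x-core       | core y-core       = core-sides x-core y-core

  labelling : DisjointnessLabelling G
  labelling with any? core?
  ... | yes (d₀ , d₀-core) = labelling-from-sides (adj G d₀) (core-bipartite d₀-core)
  ... | no ¬core           = labelling-from-sides (λ _ → false) λ x-core _ → ⊥-elim (¬core (_ , x-core))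

forbidden-free⇒labelling : ∀ {G} → Forbidden12 G → DisjointnessLabelling G
forbidden-free⇒labelling {G} (no2K2 , noP4 , noK3+K1 , noK2+K1⋆2K1 , noC4⋆2K1) =
  ForbiddenFree.labelling G no2K2 noP4 noK3+K1 noK2+K1⋆2K1 noC4⋆2K1

theorem12 : (G : Graph) →
    (CowAtMost G 2 ⇔ Forbidden12 G) × (Forbidden12 G ⇔ ObtainedBySubst G G2 G2-clique?)
theorem12 G =
  mk⇔ (labelling⇒forbidden-free {G} ∘ to) (from ∘ forbidden-free⇒labelling {G}) ,
  mk⇔ (labelling⇒blowUp {G} ∘ forbidden-free⇒labelling {G})
      (labelling⇒forbidden-free {G} ∘ blowUp⇒labelling {G})
  where open Equivalence (cow≤2⇔labelling {G})
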